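{- Let $G$ be a finite simple graph and $A$ a forcing arc set of $G$. For every clique $K$ of $G$, $A$ contains at most one arc with both endpoints in $K$.
   Context: Zero forcing: a blue vertex $u$ may force a white neighbour $v$ if $v$ is the only white vertex in $N[u]$. An arc set of $G=(V,E)$ is a set $A$ of ordered pairs $(u,v)$ with $uv\in E$ such that $(u,v)\in A$ implies $(v,u)\notin A$. $A$ is a forcing arc set if $(V,A)$ is a collection of vertex-disjoint directed paths and there is a zero forcing process on $G$ starting from the sources (in-degree zero vertices) of $A$, with each white vertex forced by exactly one vertex and all vertices ending blue, such that $(u,v)\in A$ exactly when $u$ forces $v$. -}

module Defs where

open import Level using (0ℓ)
open import Data.Nat using (ℕ)
open import Data.Fin using (Fin)
open import Data.Product using (_×_; _,_; Σ-syntax)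
open import Data.Sum using (_⊎_)
open import Data.List using (List; []; _∷_)
open import Data.List.Membership.Propositional using (_∈_)
open import Relation.Nullary using (¬_)
open import Relation.Unary using (Pred)
open import Relation.Binary.PropositionalEquality using (_≡_; _≢_)
open import Relation.Binary.Construct.Closure.Transitive using (TransClosure)
open import Function.Bundles using (_⇔_)

record Graph (n : ℕ) : Set₁ where
  field
    Adj   : Fin n → Fin n → Set
    sym   : ∀ {u v} → Adj u v → Adj v u
    irrefl : ∀ {u} → ¬ Adj u u

open Graph public

ArcRel : ℕ → Set₁
ArcRel n = Fin n → Fin n → Set

IsArcSet : ∀ {n} → Graph n → ArcRel n → Set
IsArcSet {n} G A =
  (∀ u v → A u v → Adj G u v) × (∀ u v → A u v → ¬ A v u)

IsPathCollection : ∀ {n} → ArcRel n → Set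
IsPathCollection {n} A =
  (∀ u u' v → A u v → A u' v → u ≡ u') ×
  (∀ u v v' → A u v → A u v' → v ≡ v') ×
  (∀ v → ¬ TransClosure A v v)

IsSource : ∀ {n} → ArcRel n → Fin n → Set
IsSource {n} A v = ∀ (u : Fin n) → ¬ A u v

-- A zero forcing process, given as the chronological list of forces (u , v)
-- ("u forces v"), valid starting from the current blue set B:
-- at each step u is blue, v is white, v is a neighbour of u and every
-- other vertex of N[u] is blue (v is the only white vertex of N[u]);
-- afterwards v is blue.
-- Since a forced vertex must be white, each white vertex is forced exactly once.
ValidForcing : ∀ {n} → Graph n → Pred (Fin n) 0ℓ → List (Fin n × Fin n) → Set
ValidForcing G B [] = ∀ v → B v
ValidForcing G B ((u , v) ∷ fs) =
  B u × ¬ B v × Adj G u v ×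
  (∀ w → Adj G u w → w ≢ v → B w) ×
  ValidForcing G (λ x → B x ⊎ x ≡ v) fs

IsForcingArcSet : ∀ {n} → Graph n → ArcRel n → Set
IsForcingArcSet {n} G A =
  IsArcSet G A × IsPathCollection A ×
  Σ[ fs ∈ List (Fin n × Fin n) ]
    (ValidForcing G (IsSource A) fs × (∀ u v → A u v ⇔ ((u , v) ∈ fs)))

IsClique : ∀ {n} → Graph n → Pred (Fin n) 0ℓ → Set
IsClique {n} G K = ∀ u v → K u → K v → u ≢ v → Adj G u v

-- Once a vertex u of a clique K forces, every vertex of N[u] other than the
-- forced one is already blue, and N[u] contains K; so afterwards all of K is
-- blue and no later force can target a vertex of K. Hence two forces from K
-- into K must both be the first such force.
module Submission where

open import Defs
open import Level using (0ℓ)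
open import Data.Nat using (ℕ)
open import Data.Fin using (Fin; _≟_)
open import Data.Product using (_×_; _,_)
open import Data.Sum using (_⊎_; inj₁; inj₂)
open import Data.Empty using (⊥-elim)
open import Data.List using (List; _∷_)
open import Data.List.Membership.Propositional using (_∈_)
open import Data.List.Relation.Unary.Any using (here; there)
open import Relation.Nullary using (¬_; yes; no)
open import Relation.Unary using (Pred)
open import Relation.Binary.PropositionalEquality using (_≡_; refl; ≢-sym)
open import Function.Bundles using (Equivalence)

private
  variable
    n : ℕ
    G : Graph n
    B K : Pred (Fin n) 0ℓ
    fs : List (Fin n × Fin n)
    u v u' v' : Fin n

forced-vertex-not-blue : ValidForcing G B fs → (u , v) ∈ fs → ¬ B v
forced-vertex-not-blue (_ , v∉B , _)          (here refl) = v∉B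
forced-vertex-not-blue (_ , _ , _ , _ , rest) (there p)   Bv =
  forced-vertex-not-blue rest p (inj₁ Bv)

clique-blue-after-force : ∀ {u v} → IsClique G K → K u →
  ValidForcing G B ((u , v) ∷ fs) → ∀ w → K w → B w ⊎ w ≡ v
clique-blue-after-force {u = u} {v} clique Ku (Bu , _ , _ , others-blue , _) w Kw
  with w ≟ u | w ≟ v
... | yes refl | _        = inj₁ Bu
... | no _     | yes w≡v  = inj₂ w≡v
... | no w≢u   | no w≢v   =
  inj₁ (others-blue w (clique u w Ku Kw (≢-sym w≢u)) w≢v)

no-later-force-into-clique : IsClique G K → K u → K v' →
  ValidForcing G B ((u , v) ∷ fs) → ¬ (u' , v') ∈ fs
no-later-force-into-clique clique Ku Kv' valid@(_ , _ , _ , _ , rest) p =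
  forced-vertex-not-blue rest p (clique-blue-after-force clique Ku valid _ Kv')

clique-force-unique : IsClique G K → K u → K v → K u' → K v' →
  ValidForcing G B fs → (u , v) ∈ fs → (u' , v') ∈ fs → u ≡ u' × v ≡ v'
clique-force-unique _ _ _ _ _ _ (here refl) (here refl) = refl , refl
clique-force-unique clique Ku _ _ Kv' valid (here refl) (there q) =
  ⊥-elim (no-later-force-into-clique clique Ku Kv' valid q)
clique-force-unique clique _ Kv Ku' _ valid (there p) (here refl) =
  ⊥-elim (no-later-force-into-clique clique Ku' Kv valid p)
clique-force-unique clique Ku Kv Ku' Kv' (_ , _ , _ , _ , rest) (there p) (there q) =
  clique-force-unique clique Ku Kv Ku' Kv' rest p q

proposition5p1 : ∀ {n} (G : Graph n) (A : ArcRel n) → IsForcingArcSet G A →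
    (K : Pred (Fin n) 0ℓ) → IsClique G K →
    ∀ u v u' v' → K u → K v → K u' → K v' → A u v → A u' v' →
    u ≡ u' × v ≡ v'
proposition5p1 G A (_ , _ , fs , valid , arc⇔force) K clique u v u' v' Ku Kv Ku' Kv' a a' =
  clique-force-unique clique Ku Kv Ku' Kv' valid
    (Equivalence.to (arc⇔force u v) a) (Equivalence.to (arc⇔force u' v') a')
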